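{- Let $F$ be a $2$-cube of a layer-latin parallelepiped of size $2\times5\times2$. If $F$ has no transversal, then every $2$-cube of the same parallelepiped adjacent to $F$ has transversals with at least $2$ different ranges.
   Context: $Q_5=\{0,\dots,4\}$. A layer-latin parallelepiped of size $2\times5\times2$ is a pair of $2\times5$ arrays (layers) over $Q_5$ such that in each layer every row contains $5$ distinct symbols and every column contains $2$ distinct symbols. A $2$-cube of the parallelepiped is the $2\times2\times2$ array obtained by keeping the same two column positions in both layers; two distinct $2$-cubes are adjacent if they share a column position. A diagonal of a $2$-cube is a pair of its cells differing in all three coordinates (layer, row, column); a transversal is a diagonal whose two cells have different symbols, and its range is the set of these two symbols. -}

module Defs where

open import Data.Fin using (Fin; zero; suc; _<_)
open import Data.Nat using (ℕ)
open import Data.Product using (Σ; _×_; _,_; ∃)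
open import Data.Sum using (_⊎_)
open import Relation.Binary.PropositionalEquality using (_≡_; _≢_)
open import Relation.Nullary using (¬_)

Q₅ : Set
Q₅ = Fin 5

-- A 2×5×2 array: layer (Fin 2), row (Fin 2), column (Fin 5) ↦ symbol.
Array : Set
Array = Fin 2 → Fin 2 → Fin 5 → Q₅

IsLayerLatin : Array → Set
IsLayerLatin P =
  (∀ l r c c' → c ≢ c' → P l r c ≢ P l r c') ×
  (∀ l c r r' → r ≢ r' → P l r c ≢ P l r' c)

flip2 : Fin 2 → Fin 2
flip2 zero = suc zero
flip2 (suc _) = zero

-- A 2-cube is determined by its pair of column positions {c₁ , c₂}, represented with c₁ < c₂.
record TwoCube : Set where
  constructor cube
  field
    col₁ col₂ : Fin 5
    ordered   : col₁ < col₂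
open TwoCube public

_∈cols_ : Fin 5 → TwoCube → Set
c ∈cols F = (c ≡ col₁ F) ⊎ (c ≡ col₂ F)

Adjacent : TwoCube → TwoCube → Set
Adjacent F G = ¬ (col₁ F ≡ col₁ G × col₂ F ≡ col₂ G) × Σ (Fin 5) λ c → c ∈cols F × c ∈cols G

-- A diagonal of F: a pair of cells (l,r,c) and (1-l,1-r,c'), differing in all coordinates,
-- with c ≠ c' both columns of F.  We record the first cell; the second is determined.
record Diagonal (F : TwoCube) : Set where
  constructor diag
  field
    layer row : Fin 2
    c c'      : Fin 5
    c∈F       : c ∈cols F
    c'∈F      : c' ∈cols F
    c≢c'      : c ≢ c'
open Diagonal public

sym₁ sym₂ : (P : Array) {F : TwoCube} → Diagonal F → Q₅
sym₁ P d = P (layer d) (row d) (c d)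
sym₂ P d = P (flip2 (layer d)) (flip2 (row d)) (c' d)

IsTransversal : (P : Array) {F : TwoCube} → Diagonal F → Set
IsTransversal P d = sym₁ P d ≢ sym₂ P d

-- range of a diagonal: the (unordered) set {sym₁ , sym₂}; two ranges are equal as sets
SameRange : (P : Array) {F G : TwoCube} → Diagonal F → Diagonal G → Set
SameRange P d e =
  (sym₁ P d ≡ sym₁ P e × sym₂ P d ≡ sym₂ P e) ⊎
  (sym₁ P d ≡ sym₂ P e × sym₂ P d ≡ sym₁ P e)

HasTransversal : Array → TwoCube → Set
HasTransversal P F = Σ (Diagonal F) λ d → IsTransversal P d

HasTwoRanges : Array → TwoCube → Set
HasTwoRanges P F =
  Σ (Diagonal F) λ d → Σ (Diagonal F) λ e →
    IsTransversal P d × IsTransversal P e × ¬ SameRange P d e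

-- Let F have columns e, f and the adjacent cube G have columns e, d (d ≠ f).
-- With no transversal in F, every cell (l, r, e) carries the symbol of the
-- opposite cell (1-l, 1-r, f). Hence each diagonal of G from (l, r, e) to
-- (1-l, 1-r, d) is a transversal, as the row (1-l, 1-r) cannot repeat a symbol in
-- columns f and d. The two diagonals from (0, 0, e) and from (1, 1, e) have
-- different ranges: equal ranges would put the symbol of (0, 0, e) either at
-- (0, 0, d) or at (1, 1, e), i.e. next to the equal symbol at (1, 1, f).
module Submission where

open import Defs
open import Data.Fin using (Fin; zero; suc; _<_)
open import Data.Fin.Properties using (_≟_; <-cmp; <-irrefl; <-asym; <⇒≢)
open import Data.Product using (Σ; _×_; _,_; proj₁)
open import Data.Sum using (inj₁; inj₂)
open import Relation.Binary using (tri<; tri≈; tri>)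
open import Relation.Binary.PropositionalEquality
  using (_≡_; _≢_; refl; sym; trans; subst; ≢-sym)
open import Relation.Nullary using (¬_; contradiction)
open import Relation.Nullary.Decidable using (decidable-stable)

private variable
  P : Array
  F G : TwoCube
  k x y : Fin 5

RowLatin : Array → Set
RowLatin P = ∀ l r k k′ → k ≢ k′ → P l r k ≢ P l r k′

¬HasTransversal⇒sym₁≡sym₂ : ¬ HasTransversal P F → (D : Diagonal F) → sym₁ P D ≡ sym₂ P D
¬HasTransversal⇒sym₁≡sym₂ ¬t D = decidable-stable (_ ≟ _) (λ ≢ → ¬t (D , ≢))

∈cols-other : (F : TwoCube) → k ∈cols F → Σ (Fin 5) λ k′ → k′ ∈cols F × k ≢ k′
∈cols-other F (inj₁ refl) = col₂ F , inj₂ refl , <⇒≢ (ordered F)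
∈cols-other F (inj₂ refl) = col₁ F , inj₁ refl , ≢-sym (<⇒≢ (ordered F))

∈cols-sorted : (F : TwoCube) → x ∈cols F → y ∈cols F → x < y → x ≡ col₁ F × y ≡ col₂ F
∈cols-sorted F (inj₁ refl) (inj₁ refl) x<y = contradiction x<y (<-irrefl refl)
∈cols-sorted F (inj₁ x≡) (inj₂ y≡) _ = x≡ , y≡
∈cols-sorted F (inj₂ refl) (inj₁ refl) x<y = contradiction x<y (<-asym (ordered F))
∈cols-sorted F (inj₂ refl) (inj₂ refl) x<y = contradiction x<y (<-irrefl refl)

Adjacent⇒sharedColumn-unique : (F G : TwoCube) → Adjacent F G →
                               x ∈cols F → x ∈cols G → y ∈cols F → y ∈cols G → x ≡ y
Adjacent⇒sharedColumn-unique {x = x} {y = y} F G (F≠G , _) xF xG yF yG with <-cmp x y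
... | tri≈ _ x≡y _ = x≡y
... | tri< x<y _ _ with ∈cols-sorted F xF yF x<y | ∈cols-sorted G xG yG x<y
...   | refl , refl | x≡ , y≡ = contradiction (x≡ , y≡) F≠G
Adjacent⇒sharedColumn-unique {x = x} {y = y} F G (F≠G , _) xF xG yF yG
    | tri> _ _ y<x with ∈cols-sorted F yF xF y<x | ∈cols-sorted G yG xG y<x
...   | refl , refl | y≡ , x≡ = contradiction (y≡ , x≡) F≠G

hasTwoRanges-across : ∀ {e f d} → RowLatin P → ¬ HasTransversal P F →
                      e ∈cols F → f ∈cols F → e ≢ f →
                      e ∈cols G → d ∈cols G → e ≢ d → d ≢ f →
                      HasTwoRanges P G
hasTwoRanges-across {P = P} {G = G} {e = e} {f} {d} rowLatin ¬t eF fF e≢f eG dG e≢d d≢f =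
  through zero zero , through one one ,
  through-isTransversal zero zero , through-isTransversal one one ,
  opposite-¬SameRange
  where
  one : Fin 2
  one = suc zero

  e≡opposite-f : ∀ l r → P l r e ≡ P (flip2 l) (flip2 r) f
  e≡opposite-f l r = ¬HasTransversal⇒sym₁≡sym₂ ¬t (diag l r e f eF fF e≢f)

  through : Fin 2 → Fin 2 → Diagonal G
  through l r = diag l r e d eG dG e≢d

  through-isTransversal : ∀ l r → IsTransversal P (through l r)
  through-isTransversal l r e≡d =
    rowLatin (flip2 l) (flip2 r) f d (≢-sym d≢f) (trans (sym (e≡opposite-f l r)) e≡d)

  opposite-¬SameRange : ¬ SameRange P (through zero zero) (through one one)
  opposite-¬SameRange (inj₁ (e₀₀≡e₁₁ , _)) =
    rowLatin one one e f e≢f (trans (sym e₀₀≡e₁₁) (e≡opposite-f zero zero))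
  opposite-¬SameRange (inj₂ (e₀₀≡d₀₀ , _)) = rowLatin zero zero e d e≢d e₀₀≡d₀₀

proposition9 : (P : Array) → IsLayerLatin P → (F G : TwoCube) →
               ¬ HasTransversal P F → Adjacent F G → HasTwoRanges P G
proposition9 P latin F G ¬t adj@(_ , e , eF , eG)
  with ∈cols-other F eF | ∈cols-other G eG
... | f , fF , e≢f | d , dG , e≢d =
  hasTwoRanges-across (proj₁ latin) ¬t eF fF e≢f eG dG e≢d d≢f
  where
  d≢f : d ≢ f
  d≢f d≡f = e≢f (Adjacent⇒sharedColumn-unique F G adj eF eG fF (subst (_∈cols G) d≡f dG))
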